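{- Let $f:2^{[n]}\to\mathbb{Z}$ be submodular with $f(\emptyset)=0$ and $|f(S)|\le M$ for all $S\subseteq[n]$, where $M\in\mathbb{Z}_{>0}$, given by an evaluation oracle. Let $\mathcal{F}=\{S\subseteq[n]: |S|\le M\}$, and for each $S\in\mathcal{F}$ let $A(S)=S\cup\{i\notin S : f(S\cup\{i\})\le f(S)\}$. The algorithm that computes all $A(S)$, $S\in\mathcal{F}$, and returns $A(S_{\mathrm{out}})$ for some $S_{\mathrm{out}}\in\arg\min_{S\in\mathcal{F}} f(A(S))$ outputs a minimizer of $f$, and it can be implemented in 2 rounds using $O(n^{M+1})$ queries to the evaluation oracle.
   Context: $[n]=\{1,\dots,n\}$. A function $f:2^{[n]}\to\mathbb{R}$ is submodular if $f(S\cup\{i\})-f(S)\ge f(T\cup\{i\})-f(T)$ for all $S\subseteq T\subseteq[n]\setminus\{i\}$ and $i\in[n]$. An evaluation oracle returns $f(S)$ when queried with $S\subseteq[n]$. Parallel model: the algorithm proceeds in rounds; in each round it submits a set of queries in parallel (queries in a round may depend only on answers from earlier rounds); the total number of queries is the query complexity. -}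

module Defs where

open import Data.Nat as ℕ using (ℕ)
open import Data.Integer as ℤ using (ℤ; _-_; _≤_)
open import Data.Bool using (_∨_)
open import Data.Fin using (Fin)
open import Data.Fin.Subset using (Subset; _∪_; ⁅_⁆; _⊆_; _∉_; ∣_∣; ⊥)
open import Data.Vec using (lookup; tabulate)
open import Data.List using (List; map; length)
open import Relation.Nullary using (does)

SetFn : ℕ → Set
SetFn n = Subset n → ℤ

Submodular : ∀ {n} → SetFn n → Set
Submodular {n} f = (S T : Subset n) (i : Fin n) → S ⊆ T → i ∉ T →
  f (T ∪ ⁅ i ⁆) - f T ≤ f (S ∪ ⁅ i ⁆) - f S

Admissible : ∀ {n} → ℕ → SetFn n → Set
Admissible {n} M f = Submodular f × (f ⊥ ≡ ℤ.0ℤ) × ((S : Subset n) → ℤ.∣ f S ∣ ℕ.≤ M)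
  where
    open import Data.Product using (_×_)
    open import Relation.Binary.PropositionalEquality using (_≡_)

A : ∀ {n} → SetFn n → Subset n → Subset n
A f S = tabulate (λ i → lookup S i ∨ does (f (S ∪ ⁅ i ⁆) ℤ.≤? f S))

IsMinimizer : ∀ {n} → SetFn n → Subset n → Set
IsMinimizer {n} f X = (T : Subset n) → f X ≤ f T

IsArgminA : ∀ {n} → ℕ → SetFn n → Subset n → Set
IsArgminA {n} M f S = (∣ S ∣ ℕ.≤ M) ×
  ((T : Subset n) → ∣ T ∣ ℕ.≤ M → f (A f S) ≤ f (A f T))
  where open import Data.Product using (_×_)

-- Round 1: a fixed list of queries (depends on no answers).
-- Output: computed from the answers of both rounds only.
record TwoRoundAlg (n : ℕ) : Set where
  field
    round1 : List (Subset n)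
    round2 : List ℤ → List (Subset n)
    output : List ℤ → List ℤ → Subset n

module _ {n : ℕ} (alg : TwoRoundAlg n) (f : SetFn n) where
  open TwoRoundAlg alg

  answers1 : List ℤ
  answers1 = map f round1

  queries2 : List (Subset n)
  queries2 = round2 answers1

  run : Subset n
  run = output answers1 (map f queries2)

  numQueries : ℕ
  numQueries = length round1 ℕ.+ length queries2

{-# OPTIONS --safe #-}
module Submission where

open import Defs
open import Data.Nat using (ℕ; _≤_; _*_; _+_; _^_)
open import Data.Fin.Subset using (Subset)
open import Data.Product using (_×_; Σ; ∃)
open import Relation.Binary.PropositionalEquality using (_≡_)

open import Data.Bool using (true; false; _∨_; if_then_else_)
import Data.Bool as Bool
open import Data.Bool.Properties using (∨-zeroʳ; ∨-identityʳ)
open import Data.Empty using (⊥-elim)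
open import Data.Fin using (Fin; zero; suc)
open import Data.Fin.Properties using (any?)
open import Data.Fin.Subset using (_∈_; _∉_; _⊆_; _⊂_; _⊃_; _∪_; ⁅_⁆; ∣_∣; ⊥; inside; outside)
open import Data.Fin.Subset.Induction using (Acc; acc; ⊃-wellFounded)
open import Data.Fin.Subset.Properties
  using (_∈?_; ⊆-antisym; ⊥⊆; p⊆p∪q; x∈p∪q⁺; x∈p∪q⁻; x∈⁅x⁆; x∈⁅y⁆⇒x≡y; ∪-identityʳ; ∣p∣≤n; ∣⊥∣≡0)
open import Data.Integer as ℤ using (ℤ; +_; +≤+; 0ℤ)
import Data.Integer.Properties as ℤₚ
open import Data.List using (List; []; _∷_; [_]; _++_; map; concatMap; tabulate; length)
open import Data.List.Extrema ℤₚ.≤-totalOrder using (argmin; argmin-sel; f[argmin]≤f[xs])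
open import Data.List.Membership.Propositional using (lose) renaming (_∈_ to _∈ₗ_)
open import Data.List.Membership.Propositional.Properties
  using (∈-map⁺; ∈-map⁻; ∈-++⁺ˡ; ∈-++⁺ʳ; ∈-++⁻; ∈-tabulate⁺; ∈-concatMap⁺)
open import Data.List.Properties using (length-map; length-++; length-tabulate)
open import Data.List.Relation.Unary.All as All using ()
open import Data.List.Relation.Unary.Any using (here; there; tail)
import Data.Nat as ℕ
import Data.Nat.Properties as ℕₚ
open import Data.Nat.Tactic.RingSolver using (solve-∀)
open import Data.Product using (_,_)
open import Data.Sum using (_⊎_; inj₁; inj₂)
open import Data.Vec using ([]; _∷_; here; there; lookup)
open import Data.Vec.Properties using (≡-dec; tabulate-cong; lookup∘tabulate; []=⇒lookup; lookup⇒[]=)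
open import Function using (_∘_)
open import Relation.Nullary using (¬_; Dec; yes; no; does; ¬?; _×-dec_)
open import Relation.Nullary.Decidable using (dec-true; dec-false)
open import Relation.Binary.PropositionalEquality using (refl; sym; trans; subst; cong; cong₂; module ≡-Reasoning)

-- Growing an arbitrary minimizer greedily gives a minimizer X at which every single-element
-- extension strictly increases f. Inside X, grow S from ∅ adding only elements that strictly
-- increase f: as f is integer valued with f(∅) = 0, this keeps |S| ≤ f(S) ≤ M, so S ∈ F.
-- No element of X \ S increases f at S, while by submodularity every i ∉ X increases f at S
-- because it does so at X ⊇ S; hence A(S) = X and f(A(S_out)) ≤ f(A(S)) = min f.
-- For the algorithm, round one queries S and all S ∪ {i} (S ∈ F), which determines every
-- A(S); round two queries the sets A(S) themselves.

∣p∪⁅x⁆∣≡1+∣p∣ : ∀ {n} {p : Subset n} {x} → x ∉ p → ∣ p ∪ ⁅ x ⁆ ∣ ≡ ℕ.suc ∣ p ∣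
∣p∪⁅x⁆∣≡1+∣p∣ {p = outside ∷ p} {zero}  _   = cong (ℕ.suc ∘ ∣_∣) (∪-identityʳ p)
∣p∪⁅x⁆∣≡1+∣p∣ {p = inside ∷ p}  {zero}  x∉p = ⊥-elim (x∉p here)
∣p∪⁅x⁆∣≡1+∣p∣ {p = outside ∷ p} {suc x} x∉p = ∣p∪⁅x⁆∣≡1+∣p∣ (x∉p ∘ there)
∣p∪⁅x⁆∣≡1+∣p∣ {p = inside ∷ p}  {suc x} x∉p = cong ℕ.suc (∣p∪⁅x⁆∣≡1+∣p∣ (x∉p ∘ there))

p⊂p∪⁅x⁆ : ∀ {n} {p : Subset n} {x} → x ∉ p → p ⊂ p ∪ ⁅ x ⁆
p⊂p∪⁅x⁆ {x = x} x∉p = p⊆p∪q ⁅ x ⁆ , x , x∈p∪q⁺ (inj₂ (x∈⁅x⁆ x)) , x∉p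

p∪⁅x⁆⊆q : ∀ {n} {p q : Subset n} {x} → p ⊆ q → x ∈ q → p ∪ ⁅ x ⁆ ⊆ q
p∪⁅x⁆⊆q {p = p} {x = x} p⊆q x∈q y∈p∪⁅x⁆ with x∈p∪q⁻ p ⁅ x ⁆ y∈p∪⁅x⁆
... | inj₁ y∈p = p⊆q y∈p
... | inj₂ y∈⁅x⁆ rewrite x∈⁅y⁆⇒x≡y x y∈⁅x⁆ = x∈q

saturate : ∀ {n} (Inv : Subset n → Set) (P : Subset n → Fin n → Set) →
           (∀ S i → Dec (P S i)) →
           (∀ {S i} → i ∉ S → P S i → Inv S → Inv (S ∪ ⁅ i ⁆)) →
           ∀ {S} → Inv S → ∃ λ S′ → Inv S′ × (∀ i → i ∉ S′ → ¬ P S′ i)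
saturate {n} Inv P P? extend = go (⊃-wellFounded _)
  where
  go : ∀ {S} → Acc _⊃_ S → Inv S → ∃ λ S′ → Inv S′ × (∀ i → i ∉ S′ → ¬ P S′ i)
  go {S} (acc larger) inv with any? (λ i → ¬? (i ∈? S) ×-dec P? S i)
  ... | yes (i , i∉S , p) = go (larger (p⊂p∪⁅x⁆ i∉S)) (extend i∉S p inv)
  ... | no stuck          = S , inv , λ i i∉S p → stuck (i , i∉S , p)

boundedSubsets : (n k : ℕ) → List (Subset n)
boundedSubsets ℕ.zero    k         = [ [] ]
boundedSubsets (ℕ.suc n) ℕ.zero    = map (outside ∷_) (boundedSubsets n 0)
boundedSubsets (ℕ.suc n) (ℕ.suc k) =
  map (outside ∷_) (boundedSubsets n (ℕ.suc k)) ++ map (inside ∷_) (boundedSubsets n k)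

∈-boundedSubsets⁺ : ∀ {n} k (p : Subset n) → ∣ p ∣ ≤ k → p ∈ₗ boundedSubsets n k
∈-boundedSubsets⁺ k         []            _           = here refl
∈-boundedSubsets⁺ ℕ.zero    (outside ∷ p) ∣p∣≤0       = ∈-map⁺ (outside ∷_) (∈-boundedSubsets⁺ 0 p ∣p∣≤0)
∈-boundedSubsets⁺ (ℕ.suc k) (outside ∷ p) ∣p∣≤1+k     =
  ∈-++⁺ˡ (∈-map⁺ (outside ∷_) (∈-boundedSubsets⁺ (ℕ.suc k) p ∣p∣≤1+k))
∈-boundedSubsets⁺ (ℕ.suc k) (inside ∷ p)  (ℕ.s≤s ∣p∣≤k) =
  ∈-++⁺ʳ (map (outside ∷_) (boundedSubsets _ (ℕ.suc k))) (∈-map⁺ (inside ∷_) (∈-boundedSubsets⁺ k p ∣p∣≤k))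

∈-boundedSubsets⁻ : ∀ {n} k {p : Subset n} → p ∈ₗ boundedSubsets n k → ∣ p ∣ ≤ k
∈-boundedSubsets⁻ {ℕ.zero}  k         (here refl) = ℕ.z≤n
∈-boundedSubsets⁻ {ℕ.suc n} ℕ.zero    p∈ with ∈-map⁻ (outside ∷_) p∈
... | _ , q∈ , refl = ∈-boundedSubsets⁻ 0 q∈
∈-boundedSubsets⁻ {ℕ.suc n} (ℕ.suc k) p∈ with ∈-++⁻ (map (outside ∷_) (boundedSubsets n (ℕ.suc k))) p∈
... | inj₁ p∈ˡ with ∈-map⁻ (outside ∷_) p∈ˡ
...   | _ , q∈ , refl = ∈-boundedSubsets⁻ (ℕ.suc k) q∈
∈-boundedSubsets⁻ {ℕ.suc n} (ℕ.suc k) p∈ | inj₂ p∈ʳ with ∈-map⁻ (inside ∷_) p∈ʳ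
...   | _ , q∈ , refl = ℕ.s≤s (∈-boundedSubsets⁻ k q∈)

length-boundedSubsets-0 : ∀ n → length (boundedSubsets n 0) ≡ 1
length-boundedSubsets-0 ℕ.zero    = refl
length-boundedSubsets-0 (ℕ.suc n) = trans (length-map _ (boundedSubsets n 0)) (length-boundedSubsets-0 n)

length-boundedSubsets : ∀ n k → length (boundedSubsets (ℕ.suc n) k) ≤ 2 * ℕ.suc n ^ k
length-boundedSubsets n ℕ.zero = ℕₚ.≤-trans (ℕₚ.≤-reflexive (length-boundedSubsets-0 (ℕ.suc n))) (ℕ.s≤s ℕ.z≤n)
length-boundedSubsets ℕ.zero (ℕ.suc k) rewrite ℕₚ.^-zeroˡ k = ℕₚ.≤-refl
length-boundedSubsets (ℕ.suc n) (ℕ.suc k) = begin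
  length (map (outside ∷_) (boundedSubsets m (ℕ.suc k)) ++ map (inside ∷_) (boundedSubsets m k))
    ≡⟨ length-++ (map (outside ∷_) (boundedSubsets m (ℕ.suc k))) ⟩
  length (map (outside ∷_) (boundedSubsets m (ℕ.suc k))) + length (map (inside ∷_) (boundedSubsets m k))
    ≡⟨ cong₂ _+_ (length-map _ (boundedSubsets m (ℕ.suc k))) (length-map _ (boundedSubsets m k)) ⟩
  length (boundedSubsets m (ℕ.suc k)) + length (boundedSubsets m k)
    ≤⟨ ℕₚ.+-mono-≤ (length-boundedSubsets n (ℕ.suc k)) (length-boundedSubsets n k) ⟩
  2 * (m * m ^ k) + 2 * m ^ k
    ≡⟨ distrib m (m ^ k) ⟩
  2 * (ℕ.suc m * m ^ k)
    ≤⟨ ℕₚ.*-monoʳ-≤ 2 (ℕₚ.*-monoʳ-≤ (ℕ.suc m) (ℕₚ.^-monoˡ-≤ k (ℕₚ.n≤1+n m))) ⟩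
  2 * (ℕ.suc m * ℕ.suc m ^ k) ∎
  where
  open ℕₚ.≤-Reasoning
  m = ℕ.suc n
  distrib : ∀ a b → 2 * (a * b) + 2 * b ≡ 2 * (ℕ.suc a * b)
  distrib = solve-∀

∃-minimizer : ∀ {n} (f : SetFn n) → ∃ (IsMinimizer f)
∃-minimizer {n} f = argmin f ⊥ everything , λ T →
  All.lookup (f[argmin]≤f[xs] ⊥ everything) (∈-boundedSubsets⁺ n T (∣p∣≤n T))
  where everything = boundedSubsets n n

module _ {n : ℕ} (f : SetFn n) {S : Subset n} where

  ∈A⁺ : ∀ {i} → i ∈ S ⊎ f (S ∪ ⁅ i ⁆) ℤ.≤ f S → i ∈ A f S
  ∈A⁺ {i} i∈S⊎step≤0 = lookup⇒[]= i (A f S) (trans (lookup∘tabulate _ i) (entry i∈S⊎step≤0))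
    where
    entry : i ∈ S ⊎ f (S ∪ ⁅ i ⁆) ℤ.≤ f S → lookup S i ∨ does (f (S ∪ ⁅ i ⁆) ℤ.≤? f S) ≡ true
    entry (inj₁ i∈S)    = cong (_∨ does (f (S ∪ ⁅ i ⁆) ℤ.≤? f S)) ([]=⇒lookup i∈S)
    entry (inj₂ step≤0) = trans (cong (lookup S i ∨_) (dec-true (_ ℤ.≤? _) step≤0)) (∨-zeroʳ _)

  ∈A⁻ : ∀ {i} → i ∈ A f S → i ∈ S ⊎ f (S ∪ ⁅ i ⁆) ℤ.≤ f S
  ∈A⁻ {i} i∈A with i ∈? S | f (S ∪ ⁅ i ⁆) ℤ.≤? f S
  ... | yes i∈S | _          = inj₁ i∈S
  ... | no _    | yes step≤0 = inj₂ step≤0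
  ... | no i∉S  | no step≰0  = ⊥-elim (i∉S (lookup⇒[]= i S (begin
    lookup S i                                  ≡⟨ ∨-identityʳ _ ⟨
    lookup S i ∨ false                          ≡⟨ cong (lookup S i ∨_) (dec-false (_ ℤ.≤? _) step≰0) ⟨
    lookup S i ∨ does (f (S ∪ ⁅ i ⁆) ℤ.≤? f S) ≡⟨ lookup∘tabulate _ i ⟨
    lookup (A f S) i                            ≡⟨ []=⇒lookup i∈A ⟩
    true                                        ∎)))
    where open ≡-Reasoning

  A≡⁺ : ∀ {X} → S ⊆ X →
        (∀ {i} → i ∈ X → i ∉ S → f (S ∪ ⁅ i ⁆) ℤ.≤ f S) →
        (∀ {i} → i ∉ X → ¬ f (S ∪ ⁅ i ⁆) ℤ.≤ f S) →
        A f S ≡ X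
  A≡⁺ {X} S⊆X inX outX = ⊆-antisym A⊆X X⊆A
    where
    A⊆X : A f S ⊆ X
    A⊆X {i} i∈A with ∈A⁻ i∈A | i ∈? X
    ... | inj₁ i∈S    | _       = S⊆X i∈S
    ... | inj₂ _      | yes i∈X = i∈X
    ... | inj₂ step≤0 | no i∉X  = ⊥-elim (outX i∉X step≤0)
    X⊆A : X ⊆ A f S
    X⊆A {i} i∈X with i ∈? S
    ... | yes i∈S = ∈A⁺ (inj₁ i∈S)
    ... | no i∉S  = ∈A⁺ (inj₂ (inX i∈X i∉S))

A-cong : ∀ {n} {f g : SetFn n} {S} → g S ≡ f S → (∀ i → g (S ∪ ⁅ i ⁆) ≡ f (S ∪ ⁅ i ⁆)) → A g S ≡ A f S
A-cong {S = S} gS≡fS agree =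
  tabulate-cong (λ i → cong₂ (λ a b → lookup S i ∨ does (a ℤ.≤? b)) (agree i) gS≡fS)

+m≤i⇒m≤∣i∣ : ∀ {m i} → + m ℤ.≤ i → m ≤ ℤ.∣ i ∣
+m≤i⇒m≤∣i∣ (+≤+ m≤n) = m≤n

module _ {n : ℕ} (f : SetFn n) where

  nonincreasing-step-lifts : Submodular f → ∀ {S X i} → S ⊆ X → i ∉ X →
                             f (S ∪ ⁅ i ⁆) ℤ.≤ f S → f (X ∪ ⁅ i ⁆) ℤ.≤ f X
  nonincreasing-step-lifts submodular {S} {X} {i} S⊆X i∉X step≤0 =
    ℤₚ.i-j≤0⇒i≤j (ℤₚ.≤-trans (submodular S X i S⊆X i∉X) (ℤₚ.i≤j⇒i-j≤0 step≤0))

  ∃-saturated-minimizer : ∃ λ X → IsMinimizer f X × (∀ i → i ∉ X → ¬ f (X ∪ ⁅ i ⁆) ℤ.≤ f X)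
  ∃-saturated-minimizer with _ , minimal ← ∃-minimizer f =
    saturate (IsMinimizer f) (λ X i → f (X ∪ ⁅ i ⁆) ℤ.≤ f X) (λ X i → f (X ∪ ⁅ i ⁆) ℤ.≤? f X)
      (λ _ step≤0 minimal′ T → ℤₚ.≤-trans step≤0 (minimal′ T)) minimal

  ∃-increasing-core : f ⊥ ≡ 0ℤ → ∀ X → ∃ λ S → (S ⊆ X × + ∣ S ∣ ℤ.≤ f S) ×
                       (∀ i → i ∉ S → ¬ (i ∈ X × f S ℤ.< f (S ∪ ⁅ i ⁆)))
  ∃-increasing-core f⊥≡0 X =
    saturate (λ S → S ⊆ X × + ∣ S ∣ ℤ.≤ f S) (λ S i → i ∈ X × f S ℤ.< f (S ∪ ⁅ i ⁆))
      (λ S i → (i ∈? X) ×-dec (f S ℤ.<? f (S ∪ ⁅ i ⁆))) grow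
      (⊥⊆ , ℤₚ.≤-reflexive (trans (cong +_ (∣⊥∣≡0 n)) (sym f⊥≡0)))
    where
    grow : ∀ {S i} → i ∉ S → i ∈ X × f S ℤ.< f (S ∪ ⁅ i ⁆) →
           S ⊆ X × + ∣ S ∣ ℤ.≤ f S → S ∪ ⁅ i ⁆ ⊆ X × + ∣ S ∪ ⁅ i ⁆ ∣ ℤ.≤ f (S ∪ ⁅ i ⁆)
    grow {S} {i} i∉S (i∈X , increases) (S⊆X , ∣S∣≤fS) = p∪⁅x⁆⊆q S⊆X i∈X , (begin
      + ∣ S ∪ ⁅ i ⁆ ∣  ≡⟨ cong +_ (∣p∪⁅x⁆∣≡1+∣p∣ i∉S) ⟩
      ℤ.suc (+ ∣ S ∣) ≤⟨ ℤₚ.+-monoʳ-≤ ℤ.1ℤ ∣S∣≤fS ⟩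
      ℤ.suc (f S)     ≤⟨ ℤₚ.i<j⇒suc[i]≤j increases ⟩
      f (S ∪ ⁅ i ⁆)    ∎)
      where open ℤₚ.≤-Reasoning

module _ {n M : ℕ} {f : SetFn n} where

  A-argmin-minimizes : Admissible M f → ∀ {Sout} → IsArgminA M f Sout → IsMinimizer f (A f Sout)
  A-argmin-minimizes (submodular , f⊥≡0 , bounded) {Sout} (_ , optimal) T
    with X , minimal , saturated ← ∃-saturated-minimizer f
    with S , (S⊆X , ∣S∣≤fS) , stuck ← ∃-increasing-core f f⊥≡0 X = begin
      f (A f Sout) ≤⟨ optimal S ∣S∣≤M ⟩
      f (A f S)    ≡⟨ cong f A≡X ⟩
      f X          ≤⟨ minimal T ⟩
      f T          ∎
    where
    open ℤₚ.≤-Reasoning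
    ∣S∣≤M : ∣ S ∣ ≤ M
    ∣S∣≤M = ℕₚ.≤-trans (+m≤i⇒m≤∣i∣ ∣S∣≤fS) (bounded S)
    A≡X : A f S ≡ X
    A≡X = A≡⁺ f S⊆X (λ i∈X i∉S → ℤₚ.≮⇒≥ (λ increases → stuck _ i∉S (i∈X , increases)))
                  (λ i∉X step≤0 → saturated _ i∉X (nonincreasing-step-lifts f submodular S⊆X i∉X step≤0))

-- Sets that were never queried are answered by 0ℤ.
recall : ∀ {n} → List (Subset n) → List ℤ → SetFn n
recall (Q ∷ Qs) (a ∷ as) P = if does (≡-dec Bool._≟_ P Q) then a else recall Qs as P
recall _        _        _ = 0ℤ

recall-map : ∀ {n} (f : SetFn n) {Qs P} → P ∈ₗ Qs → recall Qs (map f Qs) P ≡ f P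
recall-map f {Q ∷ Qs} {P} P∈Qs with ≡-dec Bool._≟_ P Q
... | yes refl = refl
... | no P≢Q   = recall-map f (tail P≢Q P∈Qs)

module TwoRoundMinimization (n M : ℕ) where

  candidates : List (Subset n)
  candidates = boundedSubsets n M

  neighbourhood : Subset n → List (Subset n)
  neighbourhood S = S ∷ tabulate (λ i → S ∪ ⁅ i ⁆)

  firstRound : List (Subset n)
  firstRound = concatMap neighbourhood candidates

  module _ (answers₁ : List ℤ) where

    reconstructed : SetFn n
    reconstructed = recall firstRound answers₁

    secondRound : List (Subset n)
    secondRound = map (A reconstructed) candidates

    objective : List ℤ → Subset n → ℤ
    objective answers₂ = recall secondRound answers₂ ∘ A reconstructed

    choice : List ℤ → Subset n
    choice answers₂ = argmin (objective answers₂) ⊥ candidates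

  algorithm : TwoRoundAlg n
  algorithm = record
    { round1 = firstRound
    ; round2 = secondRound
    ; output = λ answers₁ answers₂ → A (reconstructed answers₁) (choice answers₁ answers₂)
    }

  length-concatMap-neighbourhood : ∀ Ss → length (concatMap neighbourhood Ss) ≡ length Ss * ℕ.suc n
  length-concatMap-neighbourhood []       = refl
  length-concatMap-neighbourhood (S ∷ Ss) = cong ℕ.suc (trans
    (length-++ (tabulate (λ i → S ∪ ⁅ i ⁆)))
    (cong₂ _+_ (length-tabulate _) (length-concatMap-neighbourhood Ss)))

  ⊥∈candidates : ⊥ ∈ₗ candidates
  ⊥∈candidates = ∈-boundedSubsets⁺ M ⊥ (ℕₚ.≤-trans (ℕₚ.≤-reflexive (∣⊥∣≡0 n)) ℕ.z≤n)

  module _ (f : SetFn n) where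

    numQueries-algorithm : numQueries algorithm f ≡ length candidates * ℕ.suc n + length candidates
    numQueries-algorithm = cong₂ _+_ (length-concatMap-neighbourhood candidates) (length-map _ candidates)

    private
      answers₁ : List ℤ
      answers₁ = map f firstRound

      f̂ : SetFn n
      f̂ = reconstructed answers₁

      f̃ : Subset n → ℤ
      f̃ = objective answers₁ (map f (secondRound answers₁))

      Sout : Subset n
      Sout = choice answers₁ (map f (secondRound answers₁))

    A-reconstructed : ∀ {S} → S ∈ₗ candidates → A f̂ S ≡ A f S
    A-reconstructed {S} S∈ = A-cong {f = f} {g = f̂} {S = S}
      (recall-map f (∈-concatMap⁺ neighbourhood (lose S∈ (here refl))))
      (λ i → recall-map f (∈-concatMap⁺ neighbourhood (lose S∈ (there (∈-tabulate⁺ i)))))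

    f̃≡f∘A : ∀ {S} → S ∈ₗ candidates → f̃ S ≡ f (A f S)
    f̃≡f∘A S∈ = trans (recall-map f (∈-map⁺ (A f̂) S∈)) (cong f (A-reconstructed S∈))

    Sout∈candidates : Sout ∈ₗ candidates
    Sout∈candidates with argmin-sel f̃ ⊥ candidates
    ... | inj₁ Sout≡⊥ = subst (_∈ₗ candidates) (sym Sout≡⊥) ⊥∈candidates
    ... | inj₂ Sout∈  = Sout∈

    output-algorithm : Σ (Subset n) λ S → IsArgminA M f S × (run algorithm f ≡ A f S)
    output-algorithm = Sout , (∈-boundedSubsets⁻ M Sout∈candidates , optimal) , A-reconstructed Sout∈candidates
      where
      optimal : ∀ T → ∣ T ∣ ≤ M → f (A f Sout) ℤ.≤ f (A f T)
      optimal T ∣T∣≤M = begin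
        f (A f Sout) ≡⟨ f̃≡f∘A Sout∈candidates ⟨
        _            ≤⟨ All.lookup (f[argmin]≤f[xs] ⊥ candidates) T∈ ⟩
        _            ≡⟨ f̃≡f∘A T∈ ⟩
        f (A f T)    ∎
        where
        open ℤₚ.≤-Reasoning
        T∈ = ∈-boundedSubsets⁺ M T ∣T∣≤M

queries-bound : ∀ m M L → L ≤ 2 * ℕ.suc m ^ M → L * ℕ.suc (ℕ.suc m) + L ≤ 6 * ℕ.suc m ^ (M + 1)
queries-bound m M L L≤2nᴹ = begin
  L * ℕ.suc (ℕ.suc m) + L ≡⟨ regroup L m ⟩
  L * (3 + m)             ≤⟨ ℕₚ.*-mono-≤ L≤2nᴹ 3+m≤3n ⟩
  2 * p * (3 * ℕ.suc m)   ≡⟨ reassociate p (ℕ.suc m) ⟩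
  6 * (p * ℕ.suc m)       ≡⟨ cong (6 *_) nᴹ⁺¹≡nᴹ*n ⟨
  6 * ℕ.suc m ^ (M + 1)   ∎
  where
  open ℕₚ.≤-Reasoning
  p = ℕ.suc m ^ M
  regroup : ∀ L m → L * ℕ.suc (ℕ.suc m) + L ≡ L * (3 + m)
  regroup = solve-∀
  reassociate : ∀ p n → 2 * p * (3 * n) ≡ 6 * (p * n)
  reassociate = solve-∀
  3+m≤3n : 3 + m ≤ 3 * ℕ.suc m
  3+m≤3n = ℕₚ.≤-trans (ℕₚ.+-monoʳ-≤ 3 (ℕₚ.m≤n*m m 3)) (ℕₚ.≤-reflexive (sym (ℕₚ.*-suc 3 m)))
  nᴹ⁺¹≡nᴹ*n : ℕ.suc m ^ (M + 1) ≡ p * ℕ.suc m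
  nᴹ⁺¹≡nᴹ*n = trans (ℕₚ.^-distribˡ-+-* (ℕ.suc m) M 1) (cong (p *_) (ℕₚ.*-identityʳ (ℕ.suc m)))

mainTheorem3 : ((n M : ℕ) → 1 ≤ M → (f : SetFn n) → Admissible M f →
    (Sout : Subset n) → IsArgminA M f Sout → IsMinimizer f (A f Sout))
    ×
    (Σ ℕ λ C → (n M : ℕ) → 1 ≤ n → 1 ≤ M →
    Σ (TwoRoundAlg n) λ alg → (f : SetFn n) → Admissible M f →
    (numQueries alg f ≤ C * n ^ (M + 1))
    × (Σ (Subset n) λ Sout → IsArgminA M f Sout × (run alg f ≡ A f Sout)))
mainTheorem3 = (λ _ _ _ _ admissible _ → A-argmin-minimizes admissible) , 6 , implementation
  where
  implementation : (n M : ℕ) → 1 ≤ n → 1 ≤ M →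
    Σ (TwoRoundAlg n) λ alg → (f : SetFn n) → Admissible M f →
    (numQueries alg f ≤ 6 * n ^ (M + 1)) × (Σ (Subset n) λ Sout → IsArgminA M f Sout × (run alg f ≡ A f Sout))
  implementation (ℕ.suc m) M _ _ = algorithm , λ f _ →
      ℕₚ.≤-trans (ℕₚ.≤-reflexive (numQueries-algorithm f)) (queries-bound m M _ (length-boundedSubsets m M))
    , output-algorithm f
    where open TwoRoundMinimization (ℕ.suc m) M
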